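{- It is not true in general that $F_{cd}(H)\le F_{cd}(G)$ whenever $H$ is a subgraph of $G$: there exist a finite connected graph $G$ and a connected subgraph $H$ of $G$ with $F_{cd}(H) > F_{cd}(G)$.
   Context: Color-change rule: if each vertex is colored black or white, and a black vertex $u$ has exactly one white neighbor $v$, then $v$ is recolored black. A zero forcing set of $G$ is a set $Z\subseteq V(G)$ such that, starting with exactly the vertices of $Z$ black, repeated application of the color-change rule eventually colors every vertex black. A connected dom-forcing set of $G$ is a set $S\subseteq V(G)$ such that every vertex is in $S$ or adjacent to a vertex of $S$, the induced subgraph $\langle S\rangle$ is connected, and $S$ is a zero forcing set; $F_{cd}(G)$ is the minimum size of such a set. -}

module Defs where

open import Data.Nat using (ℕ; _≤_; _<_)
open import Data.Bool using (Bool; true; false)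
open import Data.Fin using (Fin)
open import Data.Fin.Subset using (Subset; _∈_; _∉_; ∣_∣; ⊤)
open import Data.Product using (Σ; _×_; ∃; _,_)
open import Data.Sum using (_⊎_)
open import Relation.Binary.PropositionalEquality using (_≡_; _≢_)
open import Function.Definitions using (Injective)

record Graph (n : ℕ) : Set where
  field
    adj   : Fin n → Fin n → Bool
    sym   : ∀ u v → adj u v ≡ adj v u
    irrfl : ∀ u → adj u u ≡ false
open Graph public

Adj : ∀ {n} → Graph n → Fin n → Fin n → Set
Adj G u v = adj G u v ≡ true

data WalkIn {n} (G : Graph n) (S : Subset n) : Fin n → Fin n → Set where
  here : ∀ {u} → u ∈ S → WalkIn G S u u
  step : ∀ {u w v} → u ∈ S → Adj G u w → WalkIn G S w v → WalkIn G S u v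

InducedConnected : ∀ {n} → Graph n → Subset n → Set
InducedConnected G S = ∀ u v → u ∈ S → v ∈ S → WalkIn G S u v

Connected : ∀ {n} → Graph n → Set
Connected G = InducedConnected G ⊤

-- H (on Fin m) is a subgraph of G (on Fin n): an injective vertex map that
-- sends edges of H to edges of G (H is identified with its image).
IsSubgraph : ∀ {m n} → Graph m → Graph n → Set
IsSubgraph {m} {n} H G =
  Σ (Fin m → Fin n) λ f → Injective _≡_ _≡_ f × (∀ u v → Adj H u v → Adj G (f u) (f v))

-- Black Z v : v becomes black when starting from Z and repeatedly applying
-- the color-change rule (the least set containing Z closed under forcing).
data Black {n} (G : Graph n) (Z : Subset n) : Fin n → Set where
  init  : ∀ {v} → v ∈ Z → Black G Z v
  force : ∀ {u v} → Black G Z u → Adj G u v →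
          (∀ w → Adj G u w → w ≢ v → Black G Z w) → Black G Z v

ZeroForcing : ∀ {n} → Graph n → Subset n → Set
ZeroForcing G Z = ∀ v → Black G Z v

Dominating : ∀ {n} → Graph n → Subset n → Set
Dominating G S = ∀ v → v ∈ S ⊎ ∃ λ u → u ∈ S × Adj G u v

ConnDomForcing : ∀ {n} → Graph n → Subset n → Set
ConnDomForcing G S = Dominating G S × InducedConnected G S × ZeroForcing G S

FcdIs : ∀ {n} → Graph n → ℕ → Set
FcdIs G k = (∃ λ S → ConnDomForcing G S × ∣ S ∣ ≡ k)
          × (∀ S → ConnDomForcing G S → k ≤ ∣ S ∣)

-- A fort is a nonempty vertex set F such that no vertex outside F has exactly
-- one neighbour in F. The colour-change rule can never turn a vertex of a fort
-- black when no vertex of the fort starts black, so every zero forcing set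
-- meets every fort. The paw (a triangle with a pendant vertex) contains the
-- claw K₁,₃ as a spanning subgraph. In the paw the centre together with a
-- triangle vertex is a connected dom-forcing set, so F_cd(paw) = 2. In the
-- claw a connected dominating set of size at most two consists of the centre
-- and at most one leaf, and the two remaining leaves form a fort avoiding it,
-- so F_cd(claw) = 3.
module Submission where

open import Defs
open import Level using (Level)
open import Data.Nat using (ℕ; zero; suc; _<_; _≤_; _<?_)
open import Data.Nat.Properties using (≮⇒≥)
open import Data.Product using (Σ; _×_; ∃; _,_; proj₂)
open import Data.Sum using (_⊎_; inj₁; inj₂)
open import Data.Bool using (Bool; true; false)
import Data.Bool as Bool
open import Data.Fin using (Fin; zero; suc; _≟_)
open import Data.Fin.Properties using (any?; all?)
open import Data.Fin.Subset using (Subset; _∈_; _∉_; ∣_∣; ⊤; Nonempty; inside; outside)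
open import Data.Fin.Subset.Properties using (_∈?_; nonempty?; anySubset?)
open import Data.Vec using ([]; _∷_)
open import Relation.Unary using (Pred; Decidable)
open import Relation.Nullary using (Dec; yes; no; ¬_; contradiction)
open import Relation.Nullary.Decidable using (from-yes; _×-dec_; _⊎-dec_; _→-dec_; ¬?; map′)
open import Relation.Binary.PropositionalEquality using (_≢_; refl; trans)

private
  variable
    n : ℕ
    ℓ : Level

Fort : Graph n → Subset n → Set
Fort G F = Nonempty F ×
  (∀ u v → u ∉ F → v ∈ F → Adj G u v → ∃ λ w → w ≢ v × w ∈ F × Adj G u w)

black∉fort : ∀ {G : Graph n} {Z F : Subset n} → Fort G F → (∀ v → v ∈ F → v ∉ Z) →
             ∀ {v} → Black G Z v → v ∉ F
black∉fort fort disjoint (init v∈Z) v∈F = disjoint _ v∈F v∈Z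
black∉fort fort disjoint (force {u} {v} black-u u~v others) v∈F
  with proj₂ fort u v (black∉fort fort disjoint black-u) v∈F u~v
... | w , w≢v , w∈F , u~w = black∉fort fort disjoint (others w u~w w≢v) w∈F

fort-disjoint⇒¬zeroForcing : ∀ {G : Graph n} {Z F : Subset n} → Fort G F →
  (∀ v → v ∈ F → v ∉ Z) → ¬ ZeroForcing G Z
fort-disjoint⇒¬zeroForcing fort@((v , v∈F) , _) disjoint zf =
  black∉fort fort disjoint (zf v) v∈F

Obstructed : Graph n → Subset n → Set
Obstructed G S = ¬ Dominating G S ⊎ ∃ λ F → Fort G F × (∀ v → v ∈ F → v ∉ S)

obstructed⇒¬connDomForcing : ∀ {G : Graph n} {S : Subset n} →
  Obstructed G S → ¬ ConnDomForcing G S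
obstructed⇒¬connDomForcing (inj₁ ¬dom)                  (dom , _ , _) = ¬dom dom
obstructed⇒¬connDomForcing (inj₂ (F , fort , disjoint)) (_ , _ , zf)  =
  fort-disjoint⇒¬zeroForcing fort disjoint zf

connDomForcing-lowerBound : ∀ {G : Graph n} k → (∀ S → ∣ S ∣ < k → Obstructed G S) →
  ∀ S → ConnDomForcing G S → k ≤ ∣ S ∣
connDomForcing-lowerBound k small⇒obstructed S cdf =
  ≮⇒≥ λ ∣S∣<k → obstructed⇒¬connDomForcing (small⇒obstructed S ∣S∣<k) cdf

IsHub : Graph n → Subset n → Fin n → Set
IsHub G S h = ∀ u → u ∈ S → u ≢ h → Adj G h u

hub⇒inducedConnected : ∀ (G : Graph n) S h → h ∈ S → IsHub G S h → InducedConnected G S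
hub⇒inducedConnected G S h h∈S hub u v u∈S v∈S = walk-from-u
  where
  walk-from-h : WalkIn G S h v
  walk-from-h with v ≟ h
  ... | yes refl = here h∈S
  ... | no  v≢h  = step h∈S (hub v v∈S v≢h) (here v∈S)

  walk-from-u : WalkIn G S u v
  walk-from-u with u ≟ h
  ... | yes refl = walk-from-h
  ... | no  u≢h  = step u∈S (trans (Graph.sym G u h) (hub u u∈S u≢h)) walk-from-h

allSubsets? : ∀ {P : Pred (Subset n) ℓ} → Decidable P → Dec (∀ S → P S)
allSubsets? {n = zero}  P? = map′ (λ { p [] → p }) (λ p → p []) (P? [])
allSubsets? {n = suc n} P? =
  map′ (λ { (pᵢ , pₒ) (inside ∷ S) → pᵢ S ; (pᵢ , pₒ) (outside ∷ S) → pₒ S })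
       (λ p → (λ S → p (inside ∷ S)) , (λ S → p (outside ∷ S)))
       (allSubsets? (λ S → P? (inside ∷ S)) ×-dec allSubsets? (λ S → P? (outside ∷ S)))

adj? : ∀ (G : Graph n) u v → Dec (Adj G u v)
adj? G u v = adj G u v Bool.≟ true

dominating? : ∀ (G : Graph n) → Decidable (Dominating G)
dominating? G S = all? λ v → v ∈? S ⊎-dec any? λ u → u ∈? S ×-dec adj? G u v

isHub? : ∀ (G : Graph n) S h → Dec (IsHub G S h)
isHub? G S h = all? λ u → u ∈? S →-dec (¬? (u ≟ h) →-dec adj? G h u)

fort? : ∀ (G : Graph n) → Decidable (Fort G)
fort? G F = nonempty? F ×-dec
  (all? λ u → all? λ v → ¬? (u ∈? F) →-dec (v ∈? F →-dec (adj? G u v →-dec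
    any? λ w → ¬? (w ≟ v) ×-dec (w ∈? F ×-dec adj? G u w))))

obstructed? : ∀ (G : Graph n) → Decidable (Obstructed G)
obstructed? G S = ¬? (dominating? G S) ⊎-dec
  anySubset? λ F → fort? G F ×-dec all? λ v → v ∈? F →-dec ¬? (v ∈? S)

pattern c  = zero
pattern l₁ = suc zero
pattern l₂ = suc (suc zero)
pattern l₃ = suc (suc (suc zero))

clawAdj : Fin 4 → Fin 4 → Bool
clawAdj c c = false
clawAdj c _ = true
clawAdj _ c = true
clawAdj _ _ = false

pawAdj : Fin 4 → Fin 4 → Bool
pawAdj l₁ l₂ = true
pawAdj l₂ l₁ = true
pawAdj u  v  = clawAdj u v

claw : Graph 4
claw = record
  { adj   = clawAdj
  ; sym   = from-yes (all? λ u → all? λ v → clawAdj u v Bool.≟ clawAdj v u)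
  ; irrfl = from-yes (all? λ u → clawAdj u u Bool.≟ false)
  }

paw : Graph 4
paw = record
  { adj   = pawAdj
  ; sym   = from-yes (all? λ u → all? λ v → pawAdj u v Bool.≟ pawAdj v u)
  ; irrfl = from-yes (all? λ u → pawAdj u u Bool.≟ false)
  }

claw⊆paw : IsSubgraph claw paw
claw⊆paw = (λ u → u) , (λ eq → eq) ,
  from-yes (all? λ u → all? λ v → adj? claw u v →-dec adj? paw u v)

clawZ : Subset 4
clawZ = inside ∷ inside ∷ inside ∷ outside ∷ []

pawZ : Subset 4
pawZ = inside ∷ inside ∷ outside ∷ outside ∷ []

clawZ-zeroForcing : ZeroForcing claw clawZ
clawZ-zeroForcing = λ { c → black-c ; l₁ → black-l₁ ; l₂ → black-l₂ ; l₃ → black-l₃ }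
  where
  black-c : Black claw clawZ c
  black-c = init (from-yes (c ∈? clawZ))

  black-l₁ : Black claw clawZ l₁
  black-l₁ = init (from-yes (l₁ ∈? clawZ))

  black-l₂ : Black claw clawZ l₂
  black-l₂ = init (from-yes (l₂ ∈? clawZ))

  black-l₃ : Black claw clawZ l₃
  black-l₃ = force black-c refl λ
    { c  ()
    ; l₁ _ _    → black-l₁
    ; l₂ _ _    → black-l₂
    ; l₃ _ ≢l₃ → contradiction refl ≢l₃
    }

pawZ-zeroForcing : ZeroForcing paw pawZ
pawZ-zeroForcing = λ { c → black-c ; l₁ → black-l₁ ; l₂ → black-l₂ ; l₃ → black-l₃ }
  where
  black-c : Black paw pawZ c
  black-c = init (from-yes (c ∈? pawZ))

  black-l₁ : Black paw pawZ l₁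
  black-l₁ = init (from-yes (l₁ ∈? pawZ))

  black-l₂ : Black paw pawZ l₂
  black-l₂ = force black-l₁ refl λ
    { c  _ _    → black-c
    ; l₁ ()
    ; l₂ _ ≢l₂ → contradiction refl ≢l₂
    ; l₃ ()
    }

  black-l₃ : Black paw pawZ l₃
  black-l₃ = force black-c refl λ
    { c  ()
    ; l₁ _ _    → black-l₁
    ; l₂ _ _    → black-l₂
    ; l₃ _ ≢l₃ → contradiction refl ≢l₃
    }

fcd-claw : FcdIs claw 3
fcd-claw =
  ( clawZ
  , ( from-yes (dominating? claw clawZ)
    , hub⇒inducedConnected claw clawZ c (from-yes (c ∈? clawZ)) (from-yes (isHub? claw clawZ c))
    , clawZ-zeroForcing )
  , refl )
  , connDomForcing-lowerBound 3 (from-yes (allSubsets? λ S → ∣ S ∣ <? 3 →-dec obstructed? claw S))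

fcd-paw : FcdIs paw 2
fcd-paw =
  ( pawZ
  , ( from-yes (dominating? paw pawZ)
    , hub⇒inducedConnected paw pawZ c (from-yes (c ∈? pawZ)) (from-yes (isHub? paw pawZ c))
    , pawZ-zeroForcing )
  , refl )
  , connDomForcing-lowerBound 2 (from-yes (allSubsets? λ S → ∣ S ∣ <? 2 →-dec obstructed? paw S))

mainTheorem6 : Σ ℕ λ n → Σ (Graph n) λ G → Σ ℕ λ m → Σ (Graph m) λ H →
    Connected G × Connected H × IsSubgraph H G ×
    Σ ℕ λ kG → Σ ℕ λ kH → FcdIs G kG × FcdIs H kH × kG < kH
mainTheorem6 =
  4 , paw , 4 , claw ,
  hub⇒inducedConnected paw ⊤ c (from-yes (c ∈? ⊤)) (from-yes (isHub? paw ⊤ c)) ,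
  hub⇒inducedConnected claw ⊤ c (from-yes (c ∈? ⊤)) (from-yes (isHub? claw ⊤ c)) ,
  claw⊆paw ,
  2 , 3 , fcd-paw , fcd-claw , from-yes (2 <? 3)
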